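{- Let $B=(b_{ij})$ be an $N\times N$ skew-symmetric integer matrix and set $m_{k-1}=b_{k1}$ for $k=2,\dots,N$. For $1\le i,j\le N-1$ let $\varepsilon_{ij}=\frac12(m_i|m_j|-m_j|m_i|)$. Then $\mu_1B=\rho B\rho^{ -1}$ if and only if all of the following hold: (i) $m_r=m_{N-r}$ for $r=1,\dots,N-1$; (ii) for all $i>j$, $b_{ij}=m_{i-j}+\varepsilon_{1,i-j+1}+\varepsilon_{2,i-j+2}+\cdots+\varepsilon_{j-1,i-1}$ (the sum of $\varepsilon$'s being empty when $j=1$); (iii) $B$ is symmetric about the non-leading diagonal, i.e. $b_{ij}=b_{N+1-j,N+1-i}$ for all $i,j$.
   Context: Mutation at node $k$ of a skew-symmetric matrix: $\mu_kB=\tilde B$ with $\tilde b_{ij}=-b_{ij}$ if $i=k$ or $j=k$, and $\tilde b_{ij}=b_{ij}+\frac12(|b_{ik}|b_{kj}+b_{ik}|b_{kj}|)$ otherwise. $\rho$ is the $N\times N$ permutation matrix with $\rho_{i+1,i}=1$ ($1\le i\le N-1$), $\rho_{1,N}=1$ and all other entries $0$, so that $(\rho B\rho^{ -1})_{ij}=b_{i-1,j-1}$ with indices mod $N$. -}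

module Defs where

open import Data.Nat using (ℕ; zero; suc; _∸_; _<?_)
open import Data.Integer using (ℤ; +_; _+_; _*_; -_; ∣_∣)
open import Data.Integer.DivMod using (_/ℕ_)
open import Data.Fin using (Fin; zero; suc; fromℕ; inject₁; fromℕ<) renaming (_≟_ to _≟F_)
open import Relation.Nullary using (yes; no)
open import Relation.Binary.PropositionalEquality using (_≡_)

Mat : ℕ → Set
Mat N = Fin N → Fin N → ℤ

SkewSymmetric : ∀ {N} → Mat N → Set
SkewSymmetric {N} B = (i j : Fin N) → B i j ≡ - B j i

absℤ : ℤ → ℤ
absℤ x = + ∣ x ∣

-- halving (used only on even integers, where it is exact)
half : ℤ → ℤ
half x = x /ℕ 2

mutate : ∀ {N} → Fin N → Mat N → Mat N
mutate k B i j with i ≟F k | j ≟F k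
... | yes _ | _     = - B i j
... | no _  | yes _ = - B i j
... | no _  | no _  = B i j + half (absℤ (B i k) * B k j + B i k * absℤ (B k j))

cycPred : ∀ {n} → Fin (suc n) → Fin (suc n)
cycPred {n} zero = fromℕ n
cycPred (suc i) = inject₁ i

-- (ρ B ρ⁻¹)_{ij} = b_{i-1,j-1}, indices mod N
conjρ : ∀ {n} → Mat (suc n) → Mat (suc n)
conjρ B i j = B (cycPred i) (cycPred j)

-- 1-based entry access b_{ij} for 1 ≤ i,j ≤ N (value 0 outside this range,
-- which is never used in the statement)
entry : ∀ {N} → Mat N → ℕ → ℕ → ℤ
entry B zero _ = + 0
entry B (suc i) zero = + 0
entry {N} B (suc i) (suc j) with i <? N | j <? N
... | yes p | yes q = B (fromℕ< p) (fromℕ< q)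
... | _     | _     = + 0

mm : ∀ {N} → Mat N → ℕ → ℤ
mm B r = entry B (suc r) 1

eps : ∀ {N} → Mat N → ℕ → ℕ → ℤ
eps B i j = half (mm B i * absℤ (mm B j) + - (mm B j * absℤ (mm B i)))

sumFrom1 : ℕ → (ℕ → ℤ) → ℤ
sumFrom1 zero f = + 0
sumFrom1 (suc n) f = sumFrom1 n f + f (suc n)

-- Away from the first row and column, μ₁B = ρBρ⁻¹ is the shift rule b_{i+1,j+1} = b_{ij} + ε_{ji};
-- on the first row it says b_{Nj} = m_j. Summing the shift rule along a diagonal gives (ii). On
-- the last row, b_{Nj} = m_j combined with (ii) expresses m_j as m_{N-j} plus a sum of ε's that
-- cancel in pairs by antisymmetry once (i) is known for smaller indices; this proves (i) by
-- induction. Reflection through the anti-diagonal maps the shift rule to itself, with (i)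
-- matching the ε-terms, so (iii) follows by induction from the corner entries. Conversely (i)
-- and (iii) give the first-row equation, and (ii) with skew-symmetry gives the shift rule.

module Submission where

open import Defs
open import Data.Nat using (ℕ; zero; suc; _∸_; _+_; _*_; _≤_; _<_; _<?_; z≤n; s≤s)
open import Data.Nat.Properties
  using (≤-refl; ≤-reflexive; ≤-trans; ≤-<-trans; ≤-pred; <⇒≤; m≤n⇒m≤1+n; <-cmp;
         m≤m+n; m≤n+m; m<m+n; m<n+m; m<n⇒0<n∸m;
         +-identityʳ; +-comm; +-assoc; +-suc; *-comm; suc-injective;
         m+[n∸m]≡n; m∸n+n≡m; m+n∸n≡m; n∸n≡0; +-∸-assoc)
open import Data.Nat.Induction using (<-rec)
import Data.Nat.DivMod as ℕ
open import Data.Integer using (ℤ; +_; -[1+_]; -_) renaming (_+_ to _+ℤ_; _*_ to _*ℤ_)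
import Data.Integer.Properties as ℤₚ
open import Data.Integer.Tactic.RingSolver using (solve-∀)
open import Data.Fin using (Fin; zero; suc; toℕ; fromℕ; fromℕ<; inject₁; opposite)
open import Data.Fin.Properties using (fromℕ<-toℕ; toℕ<n; toℕ-fromℕ<; toℕ-inject₁; toℕ-fromℕ; opposite-prop)
open import Data.Product using (_×_; _,_; proj₁; proj₂; ∃-syntax)
open import Data.Empty using (⊥-elim)
open import Function.Bundles using (_⇔_; mk⇔; Equivalence)
open import Relation.Binary.Definitions using (tri<; tri≈; tri>)
open import Relation.Nullary using (yes; no)
open import Relation.Binary.PropositionalEquality

double≡*2 : ∀ a → a + a ≡ a * 2
double≡*2 a = trans (cong (λ x → a + x) (sym (+-identityʳ a))) (*-comm 2 a)

half-neg : ∀ k → suc k ℕ.% 2 ≡ 0 → half -[1+ k ] ≡ - + (suc k ℕ./ 2)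
half-neg k _ with suc k ℕ.% 2
half-neg k refl | .0 = refl

half-double : ∀ w → half (w +ℤ w) ≡ w
half-double (+ a) = cong +_ (trans (cong (ℕ._/ 2) (double≡*2 a)) (ℕ.m*n/n≡m a 2))
half-double -[1+ a ] =
  trans (half-neg (suc (a + a)) (trans (cong (ℕ._% 2) even) (ℕ.m*n%n≡0 (suc a) 2)))
        (cong (λ k → - + k) (trans (cong (ℕ._/ 2) even) (ℕ.m*n/n≡m (suc a) 2)))
  where
  even : suc (suc (a + a)) ≡ suc a * 2
  even = trans (cong suc (sym (+-suc a a))) (double≡*2 (suc a))

i≡-i⇒i≡0 : ∀ i → i ≡ - i → i ≡ + 0
i≡-i⇒i≡0 (+ zero) _ = refl

ε : ℤ → ℤ → ℤ
ε u v = half (u *ℤ absℤ v +ℤ - (v *ℤ absℤ u))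

ε-numerator-even : ∀ u v → ∃[ w ] u *ℤ absℤ v +ℤ - (v *ℤ absℤ u) ≡ w +ℤ w
ε-numerator-even (+ a) (+ b) =
  + 0 , trans (cong (λ x → + a *ℤ + b +ℤ - x) (ℤₚ.*-comm (+ b) (+ a))) (ℤₚ.+-inverseʳ (+ a *ℤ + b))
ε-numerator-even (+ a) -[1+ b ] = + a *ℤ + suc b , identity (+ a) (+ suc b)
  where
  identity : ∀ x y → x *ℤ y +ℤ - ((- y) *ℤ x) ≡ x *ℤ y +ℤ x *ℤ y
  identity = solve-∀
ε-numerator-even -[1+ a ] (+ b) = - + suc a *ℤ + b , identity (+ suc a) (+ b)
  where
  identity : ∀ x y → (- x) *ℤ y +ℤ - (y *ℤ x) ≡ (- x) *ℤ y +ℤ (- x) *ℤ y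
  identity = solve-∀
ε-numerator-even -[1+ a ] -[1+ b ] = + 0 , identity (+ suc a) (+ suc b)
  where
  identity : ∀ x y → (- x) *ℤ y +ℤ - ((- y) *ℤ x) ≡ + 0 +ℤ + 0
  identity = solve-∀

ε-antisym : ∀ u v → ε v u ≡ - ε u v
ε-antisym u v with ε-numerator-even u v
... | w , even = begin
  ε v u                                  ≡⟨ cong half swapped ⟩
  half (- w +ℤ - w)                      ≡⟨ half-double (- w) ⟩
  - w                                    ≡⟨ cong -_ (sym (half-double w)) ⟩
  - half (w +ℤ w)                        ≡⟨ cong (λ x → - half x) (sym even) ⟩
  - ε u v                                ∎
  where
  open ≡-Reasoning
  negate : ∀ x y → y +ℤ - x ≡ - (x +ℤ - y)
  negate = solve-∀
  swapped : v *ℤ absℤ u +ℤ - (u *ℤ absℤ v) ≡ - w +ℤ - w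
  swapped = trans (negate (u *ℤ absℤ v) (v *ℤ absℤ u)) (trans (cong -_ even) (ℤₚ.neg-distrib-+ w w))

ε-self : ∀ u → ε u u ≡ + 0
ε-self u = i≡-i⇒i≡0 (ε u u) (ε-antisym u u)

-- The correction term of the mutation rule at entry (s,t) when b_{s1} = u and b_{1t} = − v.
ε-mutation : ∀ u v → half (absℤ u *ℤ (- v) +ℤ u *ℤ absℤ (- v)) ≡ ε u v
ε-mutation u v = cong half (trans (cong (λ x → absℤ u *ℤ (- v) +ℤ u *ℤ + x) (ℤₚ.∣-i∣≡∣i∣ v))
                                  (identity (absℤ u) v (u *ℤ absℤ v)))
  where
  identity : ∀ a v c → a *ℤ (- v) +ℤ c ≡ c +ℤ - (v *ℤ a)
  identity = solve-∀

sumFrom1-cong : ∀ s {f g : ℕ → ℤ} → (∀ k → 1 ≤ k → k ≤ s → f k ≡ g k) →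
                sumFrom1 s f ≡ sumFrom1 s g
sumFrom1-cong zero    f≗g = refl
sumFrom1-cong (suc s) f≗g =
  cong₂ _+ℤ_ (sumFrom1-cong s (λ k 1≤k k≤s → f≗g k 1≤k (m≤n⇒m≤1+n k≤s))) (f≗g (suc s) (s≤s z≤n) ≤-refl)

sumFrom1-unroll : ∀ s f → sumFrom1 (suc s) f ≡ f 1 +ℤ sumFrom1 s (λ k → f (suc k))
sumFrom1-unroll zero    f = trans (ℤₚ.+-identityˡ (f 1)) (sym (ℤₚ.+-identityʳ (f 1)))
sumFrom1-unroll (suc s) f =
  trans (cong (_+ℤ f (suc (suc s))) (sumFrom1-unroll s f)) (ℤₚ.+-assoc (f 1) _ _)

sumFrom1-reverse : ∀ s f → sumFrom1 s f ≡ sumFrom1 s (λ k → f (suc s ∸ k))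
sumFrom1-reverse zero    f = refl
sumFrom1-reverse (suc s) f = begin
  sumFrom1 (suc s) f                              ≡⟨ sumFrom1-unroll s f ⟩
  f 1 +ℤ sumFrom1 s (λ k → f (suc k))             ≡⟨ cong (f 1 +ℤ_) (sumFrom1-reverse s (λ k → f (suc k))) ⟩
  f 1 +ℤ sumFrom1 s (λ k → f (suc (suc s ∸ k)))   ≡⟨ cong (f 1 +ℤ_) (sumFrom1-cong s (λ k _ k≤s → cong f (suc∸ k≤s))) ⟩
  f 1 +ℤ g                                        ≡⟨ ℤₚ.+-comm (f 1) g ⟩
  g +ℤ f 1                                        ≡⟨ cong (λ j → g +ℤ f j) (sym (m+n∸n≡m 1 s)) ⟩
  sumFrom1 (suc s) (λ k → f (suc (suc s) ∸ k))    ∎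
  where
  open ≡-Reasoning
  g : ℤ
  g = sumFrom1 s (λ k → f (suc (suc s) ∸ k))
  suc∸ : ∀ {k} → k ≤ s → suc (suc s ∸ k) ≡ suc (suc s) ∸ k
  suc∸ k≤s = sym (+-∸-assoc 1 (m≤n⇒m≤1+n k≤s))

sumFrom1-neg : ∀ s f → sumFrom1 s (λ k → - f k) ≡ - sumFrom1 s f
sumFrom1-neg zero    f = refl
sumFrom1-neg (suc s) f =
  trans (cong (_+ℤ - f (suc s)) (sumFrom1-neg s f)) (sym (ℤₚ.neg-distrib-+ (sumFrom1 s f) (f (suc s))))

sumFrom1-antisymmetric : ∀ s f → (∀ k k′ → 1 ≤ k → 1 ≤ k′ → k + k′ ≡ suc s → f k′ ≡ - f k) →
                         sumFrom1 s f ≡ + 0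
sumFrom1-antisymmetric s f anti = i≡-i⇒i≡0 (sumFrom1 s f) (begin
  sumFrom1 s f                       ≡⟨ sumFrom1-reverse s f ⟩
  sumFrom1 s (λ k → f (suc s ∸ k))   ≡⟨ sumFrom1-cong s (λ k 1≤k k≤s → anti k (suc s ∸ k) 1≤k (1≤partner k≤s) (m+[n∸m]≡n (m≤n⇒m≤1+n k≤s))) ⟩
  sumFrom1 s (λ k → - f k)           ≡⟨ sumFrom1-neg s f ⟩
  - sumFrom1 s f                     ∎)
  where
  open ≡-Reasoning
  1≤partner : ∀ {k} → k ≤ s → 1 ≤ suc s ∸ k
  1≤partner k≤s = m<n⇒0<n∸m (s≤s k≤s)

x+e≡y⇒x≡y-e : ∀ {x e y} → x +ℤ e ≡ y → x ≡ y +ℤ - e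
x+e≡y⇒x≡y-e {x} {e} refl = cancel x e
  where
  cancel : ∀ x e → x ≡ x +ℤ e +ℤ - e
  cancel = solve-∀

x≡y-e⇒x+e≡y : ∀ {x e y} → x ≡ y +ℤ - e → x +ℤ e ≡ y
x≡y-e⇒x+e≡y {e = e} {y} refl = cancel y e
  where
  cancel : ∀ y e → y +ℤ - e +ℤ e ≡ y
  cancel = solve-∀

∀-<-fromFin : ∀ {n} {P : ℕ → Set} → (∀ (t : Fin n) → P (toℕ t)) → ∀ t → t < n → P t
∀-<-fromFin {P = P} ∀t t t<n = subst P (toℕ-fromℕ< t<n) (∀t (fromℕ< t<n))

toℕ+toℕ-opposite : ∀ {n} (x : Fin (suc n)) → toℕ x + toℕ (opposite x) ≡ n
toℕ+toℕ-opposite x = trans (cong (λ k → toℕ x + k) (opposite-prop x)) (m+[n∸m]≡n (≤-pred (toℕ<n x)))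

summands-< : ∀ {x y n} → suc x + y ≡ n → x < n × y < n
summands-< {x} {y} refl = s≤s (m≤m+n x y) , s≤s (m≤n+m y x)

module Conditions (n : ℕ) (B : Mat (suc n)) (skew : SkewSymmetric B) where

  -- 0-based entries: A i j = b_{i+1,j+1}, so that m i = A i 0.
  A : ℕ → ℕ → ℤ
  A i j = entry B (suc i) (suc j)

  m : ℕ → ℤ
  m = mm B

  A-fromℕ< : ∀ {i j} (i<N : i < suc n) (j<N : j < suc n) → A i j ≡ B (fromℕ< i<N) (fromℕ< j<N)
  A-fromℕ< {i} {j} i<N j<N with i <? suc n | j <? suc n
  ... | yes _  | yes _  = refl
  ... | no i≮N | _      = ⊥-elim (i≮N i<N)
  ... | yes _  | no j≮N = ⊥-elim (j≮N j<N)

  B≡A : ∀ x y {i j} → toℕ x ≡ i → toℕ y ≡ j → B x y ≡ A i j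
  B≡A x y refl refl = sym (trans (A-fromℕ< (toℕ<n x) (toℕ<n y)) (cong₂ B (fromℕ<-toℕ x _) (fromℕ<-toℕ y _)))

  A-skew : ∀ {i j} → i ≤ n → j ≤ n → A i j ≡ - A j i
  A-skew i≤n j≤n =
    trans (A-fromℕ< (s≤s i≤n) (s≤s j≤n)) (trans (skew _ _) (cong -_ (sym (A-fromℕ< (s≤s j≤n) (s≤s i≤n)))))

  A-diagonal : ∀ {i} → i ≤ n → A i i ≡ + 0
  A-diagonal i≤n = i≡-i⇒i≡0 _ (A-skew i≤n i≤n)

  B-column : (s : Fin n) → B (suc s) zero ≡ m (suc (toℕ s))
  B-column s = B≡A (suc s) zero refl refl

  B-row : (t : Fin n) → B zero (suc t) ≡ - m (suc (toℕ t))
  B-row t = trans (B≡A zero (suc t) refl refl) (A-skew z≤n (toℕ<n t))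

  mutate-corner : mutate zero B zero zero ≡ conjρ B zero zero
  mutate-corner = trans (cong -_ (i≡-i⇒i≡0 _ (skew zero zero))) (sym (i≡-i⇒i≡0 _ (skew (fromℕ n) (fromℕ n))))

  mutate-row : (t : Fin n) → mutate zero B zero (suc t) ≡ m (suc (toℕ t))
  mutate-row t = trans (cong -_ (B-row t)) (ℤₚ.neg-involutive _)

  conjρ-row : (t : Fin n) → conjρ B zero (suc t) ≡ A n (toℕ t)
  conjρ-row t = B≡A (fromℕ n) (inject₁ t) (toℕ-fromℕ n) (toℕ-inject₁ t)

  mutate-column : (s : Fin n) → mutate zero B (suc s) zero ≡ - m (suc (toℕ s))
  mutate-column s = cong -_ (B-column s)

  conjρ-column : (s : Fin n) → conjρ B (suc s) zero ≡ - A n (toℕ s)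
  conjρ-column s = trans (B≡A (inject₁ s) (fromℕ n) (toℕ-inject₁ s) (toℕ-fromℕ n)) (A-skew (<⇒≤ (toℕ<n s)) ≤-refl)

  mutate-interior : (s t : Fin n) →
    mutate zero B (suc s) (suc t) ≡ A (suc (toℕ s)) (suc (toℕ t)) +ℤ ε (m (suc (toℕ s))) (m (suc (toℕ t)))
  mutate-interior s t = cong₂ _+ℤ_ (B≡A (suc s) (suc t) refl refl)
    (trans (cong₂ (λ u v → half (absℤ u *ℤ v +ℤ u *ℤ absℤ v)) (B-column s) (B-row t))
           (ε-mutation (m (suc (toℕ s))) (m (suc (toℕ t)))))

  conjρ-interior : (s t : Fin n) → conjρ B (suc s) (suc t) ≡ A (toℕ s) (toℕ t)
  conjρ-interior s t = B≡A (inject₁ s) (inject₁ t) (toℕ-inject₁ s) (toℕ-inject₁ t)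

  LastRowRule : Set
  LastRowRule = ∀ t → t < n → A n t ≡ m (suc t)

  ShiftsAt : ℕ → ℕ → Set
  ShiftsAt s t = A (suc s) (suc t) ≡ A s t +ℤ ε (m (suc t)) (m (suc s))

  ShiftRule : Set
  ShiftRule = ∀ s t → s < n → t < n → ShiftsAt s t

  mutate≡conjρ-row⇔ : (t : Fin n) → (mutate zero B zero (suc t) ≡ conjρ B zero (suc t)) ⇔ (A n (toℕ t) ≡ m (suc (toℕ t)))
  mutate≡conjρ-row⇔ t = mk⇔
    (λ eq → trans (sym (conjρ-row t)) (trans (sym eq) (mutate-row t)))
    (λ eq → trans (mutate-row t) (trans (sym eq) (sym (conjρ-row t))))

  mutate≡conjρ-interior⇔ : (s t : Fin n) →
    (mutate zero B (suc s) (suc t) ≡ conjρ B (suc s) (suc t)) ⇔ ShiftsAt (toℕ s) (toℕ t)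
  mutate≡conjρ-interior⇔ s t = mk⇔
    (λ eq → trans (x+e≡y⇒x≡y-e (trans (sym (mutate-interior s t)) (trans eq (conjρ-interior s t))))
                  (cong (A (toℕ s) (toℕ t) +ℤ_) (sym antisym)))
    (λ eq → trans (mutate-interior s t)
                  (trans (x≡y-e⇒x+e≡y (trans eq (cong (A (toℕ s) (toℕ t) +ℤ_) antisym))) (sym (conjρ-interior s t))))
    where
    antisym : ε (m (suc (toℕ t))) (m (suc (toℕ s))) ≡ - ε (m (suc (toℕ s))) (m (suc (toℕ t)))
    antisym = ε-antisym (m (suc (toℕ s))) (m (suc (toℕ t)))

  -- The first columns of μ₁B and ρBρ⁻¹ agree by skew-symmetry once their first rows do.
  mutate≡conjρ⇔rules : (∀ x y → mutate zero B x y ≡ conjρ B x y) ⇔ (LastRowRule × ShiftRule)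
  mutate≡conjρ⇔rules = mk⇔ to from
    where
    to : (∀ x y → mutate zero B x y ≡ conjρ B x y) → LastRowRule × ShiftRule
    to μ≡ρ = ∀-<-fromFin lastRow , λ s t s<n t<n →
      ∀-<-fromFin {P = λ s → ShiftsAt s t} (λ s → ∀-<-fromFin {P = ShiftsAt (toℕ s)} (shift s) t t<n) s s<n
      where
      lastRow : (t : Fin n) → A n (toℕ t) ≡ m (suc (toℕ t))
      lastRow t = Equivalence.to (mutate≡conjρ-row⇔ t) (μ≡ρ zero (suc t))
      shift : (s t : Fin n) → ShiftsAt (toℕ s) (toℕ t)
      shift s t = Equivalence.to (mutate≡conjρ-interior⇔ s t) (μ≡ρ (suc s) (suc t))
    from : LastRowRule × ShiftRule → ∀ x y → mutate zero B x y ≡ conjρ B x y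
    from _ zero zero = mutate-corner
    from (lastRow , _) zero (suc t) = Equivalence.from (mutate≡conjρ-row⇔ t) (lastRow (toℕ t) (toℕ<n t))
    from (lastRow , _) (suc s) zero =
      trans (mutate-column s) (trans (cong -_ (sym (lastRow (toℕ s) (toℕ<n s)))) (sym (conjρ-column s)))
    from (_ , shift) (suc s) (suc t) =
      Equivalence.from (mutate≡conjρ-interior⇔ s t) (shift (toℕ s) (toℕ t) (toℕ<n s) (toℕ<n t))

  DiagonalFormula : Set
  DiagonalFormula = ∀ d p → 1 ≤ d → d + p ≤ n → A (d + p) p ≡ m d +ℤ sumFrom1 p (λ k → eps B k (d + k))

  shiftRule⇒diagonalFormula : ShiftRule → DiagonalFormula
  shiftRule⇒diagonalFormula shift d zero _ _ = trans (cong (λ i → A i 0) (+-identityʳ d)) (sym (ℤₚ.+-identityʳ (m d)))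
  shiftRule⇒diagonalFormula shift d (suc p) 1≤d d+p<n = begin
    A (d + suc p) (suc p)                               ≡⟨ cong (λ i → A i (suc p)) (+-suc d p) ⟩
    A (suc (d + p)) (suc p)                             ≡⟨ shift (d + p) p d+p<n′ (≤-<-trans (m≤n+m p d) d+p<n′) ⟩
    A (d + p) p +ℤ ε (m (suc p)) (m (suc (d + p)))      ≡⟨ cong₂ _+ℤ_ (shiftRule⇒diagonalFormula shift d p 1≤d (<⇒≤ d+p<n′))
                                                                      (cong (λ i → ε (m (suc p)) (m i)) (sym (+-suc d p))) ⟩
    m d +ℤ sumFrom1 p f +ℤ f (suc p)                    ≡⟨ ℤₚ.+-assoc (m d) (sumFrom1 p f) (f (suc p)) ⟩
    m d +ℤ sumFrom1 (suc p) f                           ∎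
    where
    open ≡-Reasoning
    f : ℕ → ℤ
    f k = eps B k (d + k)
    d+p<n′ : d + p < n
    d+p<n′ = subst (_≤ n) (+-suc d p) d+p<n

  Palindromic : Set
  Palindromic = ∀ a b → 1 ≤ a → 1 ≤ b → a + b ≡ suc n → m a ≡ m b

  -- m (suc s) = A n s lies on the diagonal b = n − s, and by the induction hypothesis the
  -- terms ε_{k,b+k} of its diagonal formula cancel in pairs k + k′ = s + 1.
  palindromic : LastRowRule → DiagonalFormula → Palindromic
  palindromic lastRow diagonal = <-rec _ step
    where
    step : ∀ a → (∀ {a′} → a′ < a → ∀ b → 1 ≤ a′ → 1 ≤ b → a′ + b ≡ suc n → m a′ ≡ m b) →
           ∀ b → 1 ≤ a → 1 ≤ b → a + b ≡ suc n → m a ≡ m b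
    step (suc s) ih b _ 1≤b s+b≡n = begin
      m (suc s)              ≡⟨ sym (lastRow s s<n) ⟩
      A n s                  ≡⟨ cong (λ i → A i s) (sym b+s≡n) ⟩
      A (b + s) s            ≡⟨ diagonal b s 1≤b (≤-reflexive b+s≡n) ⟩
      m b +ℤ sumFrom1 s f    ≡⟨ cong (m b +ℤ_) (sumFrom1-antisymmetric s f cancel) ⟩
      m b +ℤ + 0             ≡⟨ ℤₚ.+-identityʳ (m b) ⟩
      m b                    ∎
      where
      open ≡-Reasoning
      f : ℕ → ℤ
      f k = eps B k (b + k)
      b+s≡n : b + s ≡ n
      b+s≡n = trans (+-comm b s) (suc-injective s+b≡n)
      s<n : s < n
      s<n = subst (s <_) (suc-injective s+b≡n) (m<m+n s 1≤b)
      partner : ∀ k k′ → k + k′ ≡ suc s → k′ + (b + k) ≡ suc n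
      partner k k′ k+k′≡s = begin
        k′ + (b + k)   ≡⟨ +-comm k′ (b + k) ⟩
        b + k + k′     ≡⟨ +-assoc b k k′ ⟩
        b + (k + k′)   ≡⟨ cong (λ x → b + x) k+k′≡s ⟩
        b + suc s      ≡⟨ +-comm b (suc s) ⟩
        suc s + b      ≡⟨ s+b≡n ⟩
        suc n          ∎
      cancel : ∀ k k′ → 1 ≤ k → 1 ≤ k′ → k + k′ ≡ suc s → f k′ ≡ - f k
      cancel k k′ 1≤k 1≤k′ k+k′≡s = trans
        (cong₂ ε (ih (subst (k′ <_) k+k′≡s (m<n+m k′ 1≤k)) (b + k) 1≤k′ (≤-trans 1≤b (m≤m+n b k)) (partner k k′ k+k′≡s))
                 (sym (ih (subst (k <_) k+k′≡s (m<m+n k 1≤k′)) (b + k′) 1≤k (≤-trans 1≤b (m≤m+n b k′))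
                          (partner k′ k (trans (+-comm k′ k) k+k′≡s)))))
        (ε-antisym (m k) (m (b + k)))

  AntiDiagonalSymmetricℕ : Set
  AntiDiagonalSymmetricℕ = ∀ i i′ j j′ → i + i′ ≡ n → j + j′ ≡ n → A i j ≡ A j′ i′

  antiDiagonalSymmetric : LastRowRule → ShiftRule → Palindromic → AntiDiagonalSymmetricℕ
  antiDiagonalSymmetric lastRow shift palindrome = reflect
    where
    mirrored : ∀ {i i′} → suc i + i′ ≡ n → m (suc i) ≡ m (suc i′)
    mirrored {i} {i′} e = palindrome (suc i) (suc i′) (s≤s z≤n) (s≤s z≤n) (cong suc (trans (+-suc i i′) e))
    first-column : ∀ {i i′} → suc i + i′ ≡ n → A (suc i) 0 ≡ A n i′
    first-column e = trans (mirrored e) (sym (lastRow _ (proj₂ (summands-< e))))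
    reflect : AntiDiagonalSymmetricℕ
    reflect zero    _  zero    _  refl refl = trans (A-diagonal z≤n) (sym (A-diagonal ≤-refl))
    reflect (suc i) i′ zero    _  e    refl = first-column e
    reflect zero    _  (suc j) j′ refl e    = begin
      A 0 (suc j)       ≡⟨ A-skew z≤n (proj₁ (summands-< e)) ⟩
      - A (suc j) 0     ≡⟨ cong -_ (first-column e) ⟩
      - A n j′          ≡⟨ sym (A-skew (<⇒≤ (proj₂ (summands-< e))) ≤-refl) ⟩
      A j′ n            ∎
      where open ≡-Reasoning
    reflect (suc i) i′ (suc j) j′ e e′ = begin
      A (suc i) (suc j)                                  ≡⟨ shift i j i<n j<n ⟩
      A i j +ℤ ε (m (suc j)) (m (suc i))                 ≡⟨ cong₂ _+ℤ_ inner (cong₂ ε (mirrored e′) (mirrored e)) ⟩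
      A (suc j′) (suc i′) +ℤ ε (m (suc j′)) (m (suc i′)) ≡⟨ cong₂ _+ℤ_ (shift j′ i′ j′<n i′<n) (ε-antisym u v) ⟩
      A j′ i′ +ℤ ε u v +ℤ - ε u v                        ≡⟨ sym (x+e≡y⇒x≡y-e refl) ⟩
      A j′ i′                                            ∎
      where
      open ≡-Reasoning
      u v : ℤ
      u = m (suc i′)
      v = m (suc j′)
      inner : A i j ≡ A (suc j′) (suc i′)
      inner = reflect i (suc i′) j (suc j′) (trans (+-suc i i′) e) (trans (+-suc j j′) e′)
      i<n : i < n
      i<n = proj₁ (summands-< e)
      i′<n : i′ < n
      i′<n = proj₂ (summands-< e)
      j<n : j < n
      j<n = proj₁ (summands-< e′)
      j′<n : j′ < n
      j′<n = proj₂ (summands-< e′)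

  ColumnMirror : Set
  ColumnMirror = (r : ℕ) → 1 ≤ r → r ≤ n → m r ≡ m (suc n ∸ r)

  EntryFormula : Set
  EntryFormula = (i j : ℕ) → 1 ≤ j → j < i → i ≤ suc n →
                 entry B i j ≡ m (i ∸ j) +ℤ sumFrom1 (j ∸ 1) (λ k → eps B k (i ∸ j + k))

  OppositeSymmetric : Set
  OppositeSymmetric = (x y : Fin (suc n)) → B x y ≡ B (opposite y) (opposite x)

  palindromic⇒columnMirror : Palindromic → ColumnMirror
  palindromic⇒columnMirror palindrome r 1≤r r≤n =
    palindrome r (suc n ∸ r) 1≤r (m<n⇒0<n∸m (s≤s r≤n)) (m+[n∸m]≡n (m≤n⇒m≤1+n r≤n))

  diagonalFormula⇒entryFormula : DiagonalFormula → EntryFormula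
  diagonalFormula⇒entryFormula diagonal (suc i) (suc j) _ (s≤s j<i) (s≤s i≤n) =
    subst (λ x → A x j ≡ m (i ∸ j) +ℤ sumFrom1 j (λ k → eps B k (i ∸ j + k))) i∸j+j≡i
          (diagonal (i ∸ j) j (m<n⇒0<n∸m j<i) (subst (_≤ n) (sym i∸j+j≡i) i≤n))
    where
    i∸j+j≡i : i ∸ j + j ≡ i
    i∸j+j≡i = m∸n+n≡m (<⇒≤ j<i)

  entryFormula⇒diagonalFormula : EntryFormula → DiagonalFormula
  entryFormula⇒diagonalFormula formula d p 1≤d d+p≤n =
    subst (λ e → A (d + p) p ≡ m e +ℤ sumFrom1 p (λ k → eps B k (e + k))) (m+n∸n≡m d p)
          (formula (suc (d + p)) (suc p) (s≤s z≤n) (s≤s (m<n+m p 1≤d)) (s≤s d+p≤n))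

  antiDiagonalSymmetric⇒oppositeSymmetric : AntiDiagonalSymmetricℕ → OppositeSymmetric
  antiDiagonalSymmetric⇒oppositeSymmetric reflect x y = begin
    B x y                                          ≡⟨ B≡A x y refl refl ⟩
    A (toℕ x) (toℕ y)                              ≡⟨ reflect (toℕ x) (toℕ (opposite x)) (toℕ y) (toℕ (opposite y))
                                                              (toℕ+toℕ-opposite x) (toℕ+toℕ-opposite y) ⟩
    A (toℕ (opposite y)) (toℕ (opposite x))        ≡⟨ sym (B≡A (opposite y) (opposite x) refl refl) ⟩
    B (opposite y) (opposite x)                    ∎
    where open ≡-Reasoning

  lastRowRule : ColumnMirror → OppositeSymmetric → LastRowRule
  lastRowRule mirror opposite-symmetric t t<n = begin
    A n t                                  ≡⟨ sym (B≡A (fromℕ n) y (toℕ-fromℕ n) (toℕ-fromℕ< t<N)) ⟩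
    B (fromℕ n) y                          ≡⟨ opposite-symmetric (fromℕ n) y ⟩
    B (opposite y) (opposite (fromℕ n))    ≡⟨ B≡A (opposite y) (opposite (fromℕ n))
                                                  (trans (opposite-prop y) (cong (n ∸_) (toℕ-fromℕ< t<N)))
                                                  (trans (opposite-prop (fromℕ n)) (trans (cong (n ∸_) (toℕ-fromℕ n)) (n∸n≡0 n))) ⟩
    A (n ∸ t) 0                            ≡⟨ sym (mirror (suc t) (s≤s z≤n) t<n) ⟩
    m (suc t)                              ∎
    where
    open ≡-Reasoning
    t<N : t < suc n
    t<N = s≤s (<⇒≤ t<n)
    y : Fin (suc n)
    y = fromℕ< t<N

  shiftsBelow : DiagonalFormula → ∀ s t → t < s → s < n → ShiftsAt s t
  shiftsBelow diagonal s t t<s s<n = subst (λ i → ShiftsAt i t) (m∸n+n≡m (<⇒≤ t<s)) (begin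
    A (suc (d + t)) (suc t)                       ≡⟨ cong (λ i → A i (suc t)) (sym (+-suc d t)) ⟩
    A (d + suc t) (suc t)                         ≡⟨ diagonal d (suc t) 1≤d (subst (_≤ n) (sym d+suc-t≡s) s<n) ⟩
    m d +ℤ (sumFrom1 t f +ℤ f (suc t))            ≡⟨ sym (ℤₚ.+-assoc (m d) (sumFrom1 t f) (f (suc t))) ⟩
    m d +ℤ sumFrom1 t f +ℤ f (suc t)              ≡⟨ cong₂ _+ℤ_ (sym (diagonal d t 1≤d (<⇒≤ d+t<n)))
                                                               (cong (λ i → ε (m (suc t)) (m i)) (+-suc d t)) ⟩
    A (d + t) t +ℤ ε (m (suc t)) (m (suc (d + t))) ∎)
    where
    open ≡-Reasoning
    d : ℕ
    d = s ∸ t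
    1≤d : 1 ≤ d
    1≤d = m<n⇒0<n∸m t<s
    f : ℕ → ℤ
    f k = eps B k (d + k)
    d+suc-t≡s : d + suc t ≡ suc s
    d+suc-t≡s = trans (+-suc d t) (cong suc (m∸n+n≡m (<⇒≤ t<s)))
    d+t<n : d + t < n
    d+t<n = subst (_< n) (sym (m∸n+n≡m (<⇒≤ t<s))) s<n

  diagonalFormula⇒shiftRule : DiagonalFormula → ShiftRule
  diagonalFormula⇒shiftRule diagonal s t s<n t<n with <-cmp t s
  ... | tri< t<s _ _ = shiftsBelow diagonal s t t<s s<n
  ... | tri≈ _ refl _ = trans (A-diagonal s<n) (sym (cong₂ _+ℤ_ (A-diagonal (<⇒≤ s<n)) (ε-self (m (suc s)))))
  ... | tri> _ _ s<t = begin
    A (suc s) (suc t)                               ≡⟨ A-skew s<n t<n ⟩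
    - A (suc t) (suc s)                             ≡⟨ cong -_ (shiftsBelow diagonal t s s<t t<n) ⟩
    - (A t s +ℤ ε (m (suc s)) (m (suc t)))          ≡⟨ ℤₚ.neg-distrib-+ (A t s) _ ⟩
    - A t s +ℤ - ε (m (suc s)) (m (suc t))          ≡⟨ cong₂ _+ℤ_ (sym (A-skew (<⇒≤ s<n) (<⇒≤ t<n))) (sym (ε-antisym (m (suc s)) (m (suc t)))) ⟩
    A s t +ℤ ε (m (suc t)) (m (suc s))              ∎
    where open ≡-Reasoning

mainTheorem10 : (n : ℕ) → (B : Mat (suc n)) → SkewSymmetric B →
    ((∀ i j → mutate zero B i j ≡ conjρ B i j)
     ⇔
     (((r : ℕ) → 1 ≤ r → r ≤ n → mm B r ≡ mm B (suc n ∸ r))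
      × ((i j : ℕ) → 1 ≤ j → j < i → i ≤ suc n →
           entry B i j ≡ mm B (i ∸ j) +ℤ sumFrom1 (j ∸ 1) (λ k → eps B k (i ∸ j + k)))
      × ((i j : Fin (suc n)) → B i j ≡ B (opposite j) (opposite i))))
mainTheorem10 n B skew = mk⇔ necessary sufficient
  where
  open Conditions n B skew
  open Equivalence mutate≡conjρ⇔rules using (to; from)

  necessary : (∀ x y → mutate zero B x y ≡ conjρ B x y) → ColumnMirror × EntryFormula × OppositeSymmetric
  necessary μ≡ρ with to μ≡ρ
  ... | lastRow , shift =
    palindromic⇒columnMirror palindrome ,
    diagonalFormula⇒entryFormula diagonal ,
    antiDiagonalSymmetric⇒oppositeSymmetric (antiDiagonalSymmetric lastRow shift palindrome)
    where
    diagonal : DiagonalFormula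
    diagonal = shiftRule⇒diagonalFormula shift
    palindrome : Palindromic
    palindrome = palindromic lastRow diagonal

  sufficient : ColumnMirror × EntryFormula × OppositeSymmetric → ∀ x y → mutate zero B x y ≡ conjρ B x y
  sufficient (mirror , formula , opposite-symmetric) =
    from (lastRowRule mirror opposite-symmetric , diagonalFormula⇒shiftRule (entryFormula⇒diagonalFormula formula))
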